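{- The restriction of $\Phi$ to $\mathbf{H}_{hpo}$ is injective; hence it is an injective morphism of graded Hopf algebras $\mathbf{H}_{hpo}\to\mathbf{WQSym}^*$.
   Context: $\mathbb{K}$ is a field of characteristic zero. Rooted forests are considered up to isomorphism; $v\twoheadrightarrow w$ means there is an oriented path (possibly of length $0$) from $v$ towards the root ending at $w$. A preordered forest is $(F,\sigma)$ with $\sigma:V(F)\to\{1,\dots,q\}$ surjective; $\mathbf{H}_{po}$ is the Hopf algebra spanned by preordered forests with product the disjoint union ($\sigma^F$ on $V(F)$, $\sigma^G+\max\sigma^F$ on $V(G)$) and coproduct $\sum_{\boldsymbol v}Lea_{\boldsymbol v}(F)\otimes Roo_{\boldsymbol v}(F)$ over admissible cuts (sets of pairwise $\twoheadrightarrow$-unrelated vertices; $Lea$ is induced on vertices above the cut, $Roo$ on the rest, preorders restricted). A heap-preordered forest is one with $a\ne b$, $a\twoheadrightarrow b\Rightarrow\sigma(a)>\sigma(b)$; $\mathbf{H}_{hpo}$ is the Hopf subalgebra they span. $\mathbf{WQSym}^*$ has basis the packed words $\tau\in Surj_n$ (maps $\{1,\dots,n\}\to\{1,\dots,k\}$ onto), product of $\sigma,\tau$ = sum of shuffles of $\sigma$ with $\tau$ shifted by $\max\sigma$, coproduct $\sum_i pack(\tau(1)\dots\tau(i))\otimes pack(\tau(i+1)\dots\tau(n))$. $\Phi:\mathbf{H}_{po}\to\mathbf{WQSym}^*$ is the Hopf algebra morphism $\Phi((F,\sigma))=\sum_{\tau\in Surj_{|F|_v}}\mathrm{card}(\mathbb{S}^\tau_{(F,\sigma)})\tau$,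 where $\mathbb{S}^\tau_{(F,\sigma)}$ is the set of bijections $\varphi:V(F)\to\{1,\dots,|F|_v\}$ with $\sigma=\tau\circ\varphi$ and $v'\twoheadrightarrow v\Rightarrow\varphi(v)\ge\varphi(v')$. -}

module Defs where

open import Level using (_⊔_)
open import Data.Nat as ℕ using (ℕ; zero; suc; _≤ᵇ_)
open import Data.Fin as Fin using (Fin; toℕ)
open import Data.Fin.Properties using () renaming (_≟_ to _≟F_)
open import Data.Maybe using (Maybe; just; nothing)
import Data.Maybe as Maybe
open import Data.Bool using (Bool; true; false; _∧_; _∨_; if_then_else_; not)
open import Data.List as List using (List; []; _∷_; allFin; concatMap)
open import Data.Bool.ListAction using (all; any)
open import Data.Nat.ListAction using (sum)
open import Data.Vec as Vec using (Vec; []; _∷_; lookup)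
open import Data.Product using (Σ; ∃; _×_; _,_)
open import Relation.Nullary using (¬_; does)
open import Relation.Binary.PropositionalEquality using (_≡_; _≢_)
open import Function using (_∘_)
open import Function.Bundles using (_↔_; Inverse)
open import Algebra.Bundles using (CommutativeRing)

ringFromℕ : ∀ {c ℓ} (R : CommutativeRing c ℓ) → ℕ → CommutativeRing.Carrier R
ringFromℕ R zero    = CommutativeRing.0# R
ringFromℕ R (suc n) = CommutativeRing._+_ R (CommutativeRing.1# R) (ringFromℕ R n)

record CharZeroField (c ℓ : Level.Level) : Set (Level.suc (c ⊔ ℓ)) where
  field
    commRing : CommutativeRing c ℓ
  open CommutativeRing commRing public
  field
    1≉0      : ¬ (1# ≈ 0#)
    inverse  : ∀ x → ¬ (x ≈ 0#) → ∃ λ y → (x * y) ≈ 1#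
    charZero : ∀ n → ¬ (ringFromℕ commRing (suc n) ≈ 0#)
  fromℕ : ℕ → Carrier
  fromℕ = ringFromℕ commRing

_==_ : ∀ {n} → Fin n → Fin n → Bool
a == b = does (a ≟F b)

allF : ∀ n → (Fin n → Bool) → Bool
allF n p = all p (allFin n)

anyF : ∀ n → (Fin n → Bool) → Bool
anyF n p = any p (allFin n)

-- Preordered rooted forests.
-- Vertices are Fin n; parent v = nothing iff v is a root; edges point
-- towards the root.  σ : V → {1..q} is surjective (here Fin q).

step : ∀ {n} → (Fin n → Maybe (Fin n)) → Maybe (Fin n) → Maybe (Fin n)
step par nothing  = nothing
step par (just v) = par v

iter : ∀ {n} → (Fin n → Maybe (Fin n)) → ℕ → Maybe (Fin n) → Maybe (Fin n)
iter par zero    x = x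
iter par (suc k) x = step par (iter par k x)

record PForest : Set where
  field
    n       : ℕ
    parent  : Fin n → Maybe (Fin n)
    acyclic : ∀ v → iter parent n (just v) ≡ nothing
    q       : ℕ
    σ       : Fin n → Fin q
    σ-surj  : ∀ j → ∃ λ v → σ v ≡ j

reach : ∀ {n} → (Fin n → Maybe (Fin n)) → ℕ → Fin n → Fin n → Bool
reach par zero    v w = v == w
reach par (suc k) v w with par v
... | nothing = v == w
... | just p  = (v == w) ∨ reach par k p w

-- v ↠ w  (oriented path from v towards the root ending at w);
-- in a forest with n vertices such paths have length < n.
↠ : (F : PForest) → Fin (PForest.n F) → Fin (PForest.n F) → Bool
↠ F v w = reach (PForest.parent F) (PForest.n F) v w

IsHeap : PForest → Set
IsHeap F = ∀ a b → a ≢ b → ↠ F a b ≡ true → toℕ (σ b) ℕ.< toℕ (σ a)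
  where open PForest F

record HPForest : Set where
  field
    forest : PForest
    heap   : IsHeap forest

record Iso (F G : PForest) : Set where
  private module F = PForest F
  private module G = PForest G
  field
    bij    : Fin F.n ↔ Fin G.n
  open Inverse bij using (to)
  field
    parent-hom : ∀ v → G.parent (to v) ≡ Maybe.map to (F.parent v)
    σ-hom      : ∀ v → toℕ (G.σ (to v)) ≡ toℕ (F.σ v)

-- τ : {1..N} → {1..k} is a packed word iff it is onto
Surjective : ∀ {N k} → (Fin N → Fin k) → Set
Surjective {N} {k} τ = ∀ j → ∃ λ i → τ i ≡ j

allVecs : ∀ N n → List (Vec (Fin N) n)
allVecs N zero    = [] ∷ []
allVecs N (suc n) = concatMap (λ x → List.map (x ∷_) (allVecs N n)) (allFin N)

inS : (F : PForest) → ∀ {N k} → (Fin N → Fin k) → (Fin (PForest.n F) → Fin N) → Bool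
inS F {N} {k} τ φ =
      allF n (λ a → allF n (λ b → not (φ a == φ b) ∨ (a == b)))
    ∧ allF N (λ y → anyF n (λ x → φ x == y))
    ∧ allF n (λ v → toℕ (σ v) ℕ.≡ᵇ toℕ (τ (φ v)))
    ∧ allF n (λ v' → allF n (λ v → not (↠ F v' v) ∨ (toℕ (φ v') ≤ᵇ toℕ (φ v))))
  where open PForest F

card-S : (F : PForest) → ∀ {N k} → (Fin N → Fin k) → ℕ
card-S F {N} τ =
  sum (List.map (λ v → if inS F τ (lookup v) then 1 else 0) (allVecs N (PForest.n F)))

module _ {c ℓ} (K : CharZeroField c ℓ) where
  open CharZeroField K
  ΣK : ∀ r → (Fin r → Carrier) → Carrier
  ΣK zero    f = 0#
  ΣK (suc r) f = f Fin.zero + ΣK r (f ∘ Fin.suc)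

-- Φ(F) counts, for each packed word w, the realizations of F on w: bijections from the vertices
-- to the positions of w, carrying labels to letters, that place every vertex before its
-- ancestors. Call a realization nice when the parent of each vertex sits at the nearest later
-- position holding a smaller letter; then w determines the forest, so a word has nice
-- realizations of at most one forest up to isomorphism. In a heap-preordered forest a vertex is
-- labelled above its parent, and a realization that is not nice can be pushed to a strictly
-- larger word in reverse lexicographic order, by cycling one letter to the right. So, by
-- descending induction on w: if F_j is realized on w, either a larger word realizes it (and its
-- coefficient vanishes by induction) or the realization is nice; then every other forest of the
-- family is realized on w only non-nicely, hence has coefficient zero, and the relation at w is
-- coeff_j · |𝕊^w_{F_j}| = 0 with a positive count, which forces coeff_j = 0 in characteristic
-- zero. Every heap-preordered forest is realized on some word, e.g. by listing its vertices by
-- decreasing label.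

module Submission where

open import Defs
open import Level using (Level)
open import Data.Nat using (ℕ)
open import Data.Fin using (Fin)
open import Relation.Binary.PropositionalEquality using (_≡_)

open import Data.Bool using (Bool; true; false; T; not; _∧_; _∨_; if_then_else_)
open import Data.Bool.Properties using (T-≡; ∨-zeroʳ)
open import Data.Empty using (⊥-elim)
open import Data.Fin.Base using (toℕ; fromℕ<; zero; suc; _≤_; _<_; punchIn; punchOut; combine)
open import Data.Fin.Permutation as Perm
  using ( Permutation; Permutation′; permutation; _⟨$⟩ʳ_; _⟨$⟩ˡ_; inverseˡ; inverseʳ; _∘ₚ_; flip
        ; insert; insert-punchIn)
open import Data.Fin.Properties
  using ( suc-injective; toℕ<n; toℕ-fromℕ<; toℕ-injective; _≟_; _<?_; all?; any?; ¬∀⟶∃¬; <-cmp; <-irrefl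
        ; <⇒≢; ≤∧≢⇒<; pigeonhole; combine-injective; combine-monoˡ-<
        ; punchIn-punchOut; punchIn-mono-≤; punchOut-mono-≤; punchOut-injective)
open import Data.List.Base as List using (List; _∷_; allFin)
open import Data.List.Membership.Propositional using (_∈_; lose)
open import Data.List.Membership.Propositional.Properties using (∈-allFin; ∈-concatMap⁺; ∈-map⁺)
import Data.List.Relation.Unary.All as All
open import Data.List.Relation.Unary.All.Properties using (all⁺; all⁻; tabulate⁺)
open import Data.List.Relation.Unary.Any using (Any; here; there; satisfied)
open import Data.List.Relation.Unary.Any.Properties using (any⁺; any⁻)
open import Data.Maybe.Base as Maybe using (Maybe; just; nothing)
open import Data.Maybe.Properties using (just-injective; ≡-dec; map-injective; map-cong; map-∘)
open import Data.Nat.Base as ℕ using (zero; suc)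
import Data.Nat.Induction as ℕ
open import Data.Nat.ListAction using (sum)
import Data.Nat.Properties as ℕ
open import Data.Product using (∃; _×_; _,_; proj₁; proj₂)
open import Data.Sum using (_⊎_; inj₁; inj₂; [_,_]′)
open import Data.Unit using (tt)
open import Data.Vec.Base using (Vec; []; _∷_; lookup; tabulate)
open import Data.Vec.Properties using (lookup∘tabulate)
open import Function using (_∘_; id; Equivalence; Injection; Injective)
open import Function.Properties.Inverse using (↔⇒↣)
open import Induction.WellFounded as WF using (WellFounded)
open import Level using (0ℓ)
import Relation.Binary.Construct.On as On
open import Relation.Binary.Definitions using (tri<; tri≈; tri>)
open import Relation.Binary.PropositionalEquality
  using (_≢_; ≢-sym; refl; sym; trans; cong; cong₂; subst; subst₂; module ≡-Reasoning)
open import Relation.Nullary using (¬_; Dec; does; yes; no; _×-dec_)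
open import Relation.Unary using (Pred; Decidable)

module _ {n : ℕ} (p : Fin n → Bool) where

  allF⁻ : T (allF n p) → ∀ x → T (p x)
  allF⁻ h x = All.lookup (all⁺ p (allFin n) h) (∈-allFin x)

  allF⁺ : (∀ x → T (p x)) → T (allF n p)
  allF⁺ h = all⁻ p (tabulate⁺ h)

  anyF⁻ : T (anyF n p) → ∃ λ x → T (p x)
  anyF⁻ h = satisfied (any⁻ p (allFin n) h)

  anyF⁺ : ∀ x → T (p x) → T (anyF n p)
  anyF⁺ x px = any⁺ p (lose (∈-allFin x) px)

T-∧⁴⁻ : ∀ {a b c d} → T (a ∧ b ∧ c ∧ d) → T a × T b × T c × T d
T-∧⁴⁻ {true} {true} {true} h = _ , _ , _ , h

T-∧⁴⁺ : ∀ {a b c d} → T a × T b × T c × T d → T (a ∧ b ∧ c ∧ d)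
T-∧⁴⁺ {true} {true} {true} (_ , _ , _ , h) = h

T-not-∨⁻ : ∀ {b c} → T (not b ∨ c) → T b → T c
T-not-∨⁻ {true} h _ = h

T-not-∨⁺ : ∀ {b c} → (T b → T c) → T (not b ∨ c)
T-not-∨⁺ {true}  h = h _
T-not-∨⁺ {false} h = _

==⇒≡ : ∀ {n} {a b : Fin n} → T (a == b) → a ≡ b
==⇒≡ {a = a} {b} h with a ≟ b
... | yes a≡b = a≡b

≡⇒== : ∀ {n} {a b : Fin n} → a ≡ b → T (a == b)
≡⇒== {a = a} {b} a≡b with a ≟ b
... | yes _  = _
... | no a≢b = a≢b a≡b

⟨$⟩ʳ-injective : ∀ {m n} (π : Permutation m n) {a b} → π ⟨$⟩ʳ a ≡ π ⟨$⟩ʳ b → a ≡ b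
⟨$⟩ʳ-injective π = Injection.injective (↔⇒↣ π)

module _ (F : PForest) {N k : ℕ} (τ : Fin N → Fin k) where
  open PForest F

  record Realization : Set where
    field
      φ        : Permutation n N
      labels   : ∀ v → toℕ (σ v) ≡ toℕ (τ (φ ⟨$⟩ʳ v))
      monotone : ∀ a b → ↠ F a b ≡ true → φ ⟨$⟩ʳ a ≤ φ ⟨$⟩ʳ b

  inS⇒realization : (f : Fin n → Fin N) → T (inS F τ f) → Realization
  inS⇒realization f h with T-∧⁴⁻ h
  ... | injectiveᵇ , surjectiveᵇ , labelsᵇ , monotoneᵇ = record
    { φ        = permutation f g (λ y → proj₂ (f-surjective y)) g∘f
    ; labels   = λ v → ℕ.≡ᵇ⇒≡ _ _ (allF⁻ _ labelsᵇ v)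
    ; monotone = λ a b a↠b → ℕ.≤ᵇ⇒≤ _ _
        (T-not-∨⁻ (allF⁻ _ (allF⁻ _ monotoneᵇ a) b) (Equivalence.from T-≡ a↠b))
    }
    where
      f-surjective : ∀ y → ∃ λ x → f x ≡ y
      f-surjective y with anyF⁻ (λ x → f x == y) (allF⁻ _ surjectiveᵇ y)
      ... | x , fx==y = x , ==⇒≡ fx==y
      g : Fin N → Fin n
      g y = proj₁ (f-surjective y)
      g∘f : ∀ x → g (f x) ≡ x
      g∘f x = ==⇒≡ (T-not-∨⁻ (allF⁻ _ (allF⁻ _ injectiveᵇ (g (f x))) x)
                               (≡⇒== (proj₂ (f-surjective (f x)))))

  realization⇒inS : (ρ : Realization) (f : Fin n → Fin N) →
                    (∀ v → f v ≡ Realization.φ ρ ⟨$⟩ʳ v) → T (inS F τ f)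
  realization⇒inS ρ f f≗φ = T-∧⁴⁺
    ( (allF⁺ _ λ a → allF⁺ _ λ b → T-not-∨⁺ λ fa==fb → ≡⇒== (f-injective a b (==⇒≡ fa==fb)))
    , (allF⁺ _ λ y → anyF⁺ _ (φ ⟨$⟩ˡ y) (≡⇒== (f-φ⁻¹ y)))
    , (allF⁺ _ λ v → ℕ.≡⇒≡ᵇ _ _ (f-labels v))
    , (allF⁺ _ λ a → allF⁺ _ λ b → T-not-∨⁺ λ a↠b → ℕ.≤⇒≤ᵇ (f-monotone a b (Equivalence.to T-≡ a↠b))))
    where
      open Realization ρ
      f-injective : ∀ a b → f a ≡ f b → a ≡ b
      f-injective a b fa≡fb = ⟨$⟩ʳ-injective φ (trans (sym (f≗φ a)) (trans fa≡fb (f≗φ b)))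
      f-φ⁻¹ : ∀ y → f (φ ⟨$⟩ˡ y) ≡ y
      f-φ⁻¹ y = trans (f≗φ _) (inverseʳ φ)
      f-labels : ∀ v → toℕ (σ v) ≡ toℕ (τ (f v))
      f-labels v = trans (labels v) (cong (toℕ ∘ τ) (sym (f≗φ v)))
      f-monotone : ∀ a b → ↠ F a b ≡ true → f a ≤ f b
      f-monotone a b a↠b = subst₂ _≤_ (sym (f≗φ a)) (sym (f≗φ b)) (monotone a b a↠b)

module _ {A : Set} (b : A → Bool) where

  indicatorSum : List A → ℕ
  indicatorSum xs = sum (List.map (λ x → if b x then 1 else 0) xs)

  indicatorSum≡suc⇒Any : ∀ xs {m} → indicatorSum xs ≡ suc m → Any (T ∘ b) xs
  indicatorSum≡suc⇒Any (x ∷ xs) h with b x in bx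
  ... | true  = here (Equivalence.from T-≡ bx)
  ... | false = there (indicatorSum≡suc⇒Any xs h)

  Any⇒indicatorSum≡suc : ∀ {xs} → Any (T ∘ b) xs → ∃ λ m → indicatorSum xs ≡ suc m
  Any⇒indicatorSum≡suc {x ∷ xs} (here bx) rewrite Equivalence.to T-≡ bx = _ , refl
  Any⇒indicatorSum≡suc {x ∷ xs} (there hit) with b x
  ... | true  = _ , refl
  ... | false = Any⇒indicatorSum≡suc hit

∈-allVecs : ∀ N {n} (v : Vec (Fin N) n) → v ∈ allVecs N n
∈-allVecs N []      = here refl
∈-allVecs N (x ∷ v) = ∈-concatMap⁺ _ (lose (∈-allFin x) (∈-map⁺ (x ∷_) (∈-allVecs N v)))

module _ (F : PForest) {N k : ℕ} (τ : Fin N → Fin k) where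

  card-S≡suc⇒realization : ∀ {m} → card-S F τ ≡ suc m → Realization F τ
  card-S≡suc⇒realization h with satisfied (indicatorSum≡suc⇒Any _ (allVecs N (PForest.n F)) h)
  ... | v , v∈S = inS⇒realization F τ (lookup v) v∈S

  realization⇒card-S≡suc : Realization F τ → ∃ λ m → card-S F τ ≡ suc m
  realization⇒card-S≡suc ρ = Any⇒indicatorSum≡suc _ (lose (∈-allVecs N (tabulate place))
    (realization⇒inS F τ ρ (lookup (tabulate place)) (lookup∘tabulate place)))
    where
      place : Fin (PForest.n F) → Fin N
      place = Realization.φ ρ ⟨$⟩ʳ_

==-refl : ∀ {n} (a : Fin n) → (a == a) ≡ true
==-refl a = Equivalence.to T-≡ (≡⇒== {a = a} refl)

module _ {n : ℕ} (par : Fin n → Maybe (Fin n)) where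

  reach-refl : ∀ k v → reach par k v v ≡ true
  reach-refl zero    v = ==-refl v
  reach-refl (suc k) v with par v
  ... | nothing = ==-refl v
  ... | just _  rewrite ==-refl v = refl

  reach-suc : ∀ k v w → reach par k v w ≡ true → reach par (suc k) v w ≡ true
  reach-suc zero v w h with par v
  ... | nothing = h
  ... | just _  rewrite h = refl
  reach-suc (suc k) v w h with par v
  ... | nothing = h
  ... | just p with v == w
  ...   | true  = refl
  ...   | false = reach-suc k p w h

  iter-fixed : ∀ v → par v ≡ just v → ∀ k → iter par k (just v) ≡ just v
  iter-fixed v h zero    = refl
  iter-fixed v h (suc k) rewrite iter-fixed v h k = h

reach-parent : ∀ {n} (par : Fin n → Maybe (Fin n)) {v p} → par v ≡ just p → reach par n v p ≡ true
reach-parent {suc n} par {v} {p} h with par v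
reach-parent {suc n} par {v} {p} refl | just .p rewrite reach-refl par n p = ∨-zeroʳ (v == p)

reach-step : ∀ {n} (par : Fin n → Maybe (Fin n)) {v w} → reach par n v w ≡ true → v ≢ w →
             ∃ λ p → par v ≡ just p × reach par n p w ≡ true
reach-step {suc n} par {v} {w} h v≢w with par v
... | nothing = ⊥-elim (v≢w (==⇒≡ (Equivalence.from T-≡ h)))
... | just p with v ≟ w
...   | yes v≡w = ⊥-elim (v≢w v≡w)
...   | no _    = p , refl , reach-suc par n p w h

module _ (F : PForest) where
  open PForest F

  parent-irrefl : ∀ v → parent v ≢ just v
  parent-irrefl v h with trans (sym (acyclic v)) (iter-fixed parent v h n)
  ... | ()

  ↠-parent : ∀ {v p} → parent v ≡ just p → ↠ F v p ≡ true
  ↠-parent = reach-parent parent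

  ↠-step : ∀ {v w} → ↠ F v w ≡ true → v ≢ w → ∃ λ p → parent v ≡ just p × ↠ F p w ≡ true
  ↠-step = reach-step parent

  heap-parent : IsHeap F → ∀ {v p} → parent v ≡ just p → σ p < σ v
  heap-parent heap {v} h =
    heap v _ (λ v≡p → parent-irrefl v (subst (λ x → parent v ≡ just x) (sym v≡p) h)) (↠-parent h)

-- Nice realizations

first : ∀ {N} {P : Pred (Fin N) 0ℓ} → Decidable P → Maybe (Fin N)
first {zero}  P? = nothing
first {suc N} P? with P? zero
... | yes _ = just zero
... | no  _ = Maybe.map suc (first (P? ∘ suc))

first-nothing : ∀ {N} {P : Pred (Fin N) 0ℓ} (P? : Decidable P) → first P? ≡ nothing → ∀ t → ¬ P t
first-nothing {suc N} P? h t with P? zero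
first-nothing {suc N} P? () t       | yes _
first-nothing {suc N} P? h zero    | no ¬P0 = ¬P0
first-nothing {suc N} P? h (suc t) | no _ with first (P? ∘ suc) in eq
first-nothing {suc N} P? () (suc t) | no _ | just _
... | nothing = first-nothing (P? ∘ suc) eq t

first-just : ∀ {N} {P : Pred (Fin N) 0ℓ} (P? : Decidable P) {t} → first P? ≡ just t →
             P t × (∀ s → s < t → ¬ P s)
first-just {suc N} P? h with P? zero
first-just {suc N} P? refl | yes P0 = P0 , λ _ ()
... | no ¬P0 with first (P? ∘ suc) in eq
first-just {suc N} P? refl | no ¬P0 | just t with first-just (P? ∘ suc) eq
... | Pt , minimal = Pt , λ { zero _ → ¬P0 ; (suc s) (ℕ.s≤s s<t) → minimal s s<t }
first-just {suc N} P? () | no _ | nothing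

module _ {N k : ℕ} (w : Fin N → Fin k) where

  SmallerAfter : Fin N → Fin N → Set
  SmallerAfter p t = p < t × w t < w p

  nearestSmaller : Fin N → Maybe (Fin N)
  nearestSmaller p = first {P = SmallerAfter p} (λ t → (p <? t) ×-dec (w t <? w p))

module _ (F : PForest) {N k : ℕ} (w : Fin N → Fin k) where
  open PForest F

  NiceAt : Realization F w → Fin n → Set
  NiceAt ρ v = Maybe.map (φ ⟨$⟩ʳ_) (parent v) ≡ nearestSmaller w (φ ⟨$⟩ʳ v)
    where open Realization ρ

  Nice : Realization F w → Set
  Nice ρ = ∀ v → NiceAt ρ v

  niceAt? : ∀ ρ v → Dec (NiceAt ρ v)
  niceAt? ρ v = ≡-dec _≟_ (Maybe.map (φ ⟨$⟩ʳ_) (parent v)) (nearestSmaller w (φ ⟨$⟩ʳ v))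
    where open Realization ρ

  nice? : ∀ ρ → Dec (Nice ρ)
  nice? ρ = all? (niceAt? ρ)

nice⇒iso : ∀ {F G : PForest} {N k} {w : Fin N → Fin k} (ρ : Realization F w) (θ : Realization G w) →
           Nice F w ρ → Nice G w θ → Iso F G
nice⇒iso {F} {G} {w = w} ρ θ ρ-nice θ-nice = record
  { bij        = ρ.φ ∘ₚ flip θ.φ
  ; parent-hom = parent-hom
  ; σ-hom      = λ v → begin
      toℕ (G.σ (to v))              ≡⟨ θ.labels (to v) ⟩
      toℕ (w (θ.φ ⟨$⟩ʳ to v))       ≡⟨ cong (toℕ ∘ w) (inverseʳ θ.φ) ⟩
      toℕ (w (ρ.φ ⟨$⟩ʳ v))          ≡⟨ ρ.labels v ⟨
      toℕ (F.σ v)                   ∎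
  }
  where
    module F = PForest F
    module G = PForest G
    module ρ = Realization ρ
    module θ = Realization θ
    open ≡-Reasoning
    to : Fin F.n → Fin G.n
    to v = θ.φ ⟨$⟩ˡ (ρ.φ ⟨$⟩ʳ v)
    parent-hom : ∀ v → G.parent (to v) ≡ Maybe.map to (F.parent v)
    parent-hom v = map-injective (⟨$⟩ʳ-injective θ.φ) (begin
      Maybe.map (θ.φ ⟨$⟩ʳ_) (G.parent (to v))               ≡⟨ θ-nice (to v) ⟩
      nearestSmaller w (θ.φ ⟨$⟩ʳ to v)                      ≡⟨ cong (nearestSmaller w) (inverseʳ θ.φ) ⟩
      nearestSmaller w (ρ.φ ⟨$⟩ʳ v)                         ≡⟨ ρ-nice v ⟨
      Maybe.map (ρ.φ ⟨$⟩ʳ_) (F.parent v)                    ≡⟨ map-cong (λ _ → inverseʳ θ.φ) (F.parent v) ⟨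
      Maybe.map ((θ.φ ⟨$⟩ʳ_) ∘ to) (F.parent v)             ≡⟨ map-∘ (F.parent v) ⟩
      Maybe.map (θ.φ ⟨$⟩ʳ_) (Maybe.map to (F.parent v))     ∎)

-- Reverse lexicographic order on words

infix 4 _≻_

_≻_ : ∀ {N k} → (Fin N → Fin k) → (Fin N → Fin k) → Set
w′ ≻ w = ∃ λ p → (∀ t → p < t → w′ t ≡ w t) × w p < w′ p

module _ where
  open import Data.Nat.Base using (_+_; _*_; _^_; _∸_)

  value : ∀ {N k} → (Fin N → Fin k) → ℕ
  value {zero}      w = 0
  value {suc N} {k} w = toℕ (w zero) + k * value (w ∘ suc)

  value-cong : ∀ {N k} {w w′ : Fin N → Fin k} → (∀ t → w t ≡ w′ t) → value w ≡ value w′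
  value-cong {zero}      w≗w′ = refl
  value-cong {suc N} {k} w≗w′ = cong₂ (λ d r → toℕ d + k * r) (w≗w′ zero) (value-cong (w≗w′ ∘ suc))

  digit+k*r<k*[1+r] : ∀ {k} (d : Fin k) r → toℕ d + k * r ℕ.< k * suc r
  digit+k*r<k*[1+r] {k} d r = ℕ.≤-trans (ℕ.+-monoˡ-< (k * r) (toℕ<n d)) (ℕ.≤-reflexive (sym (ℕ.*-suc k r)))

  value<k^N : ∀ {N k} (w : Fin N → Fin k) → value w ℕ.< k ^ N
  value<k^N {zero}      w = ℕ.s≤s ℕ.z≤n
  value<k^N {suc N} {k} w = ℕ.<-≤-trans (digit+k*r<k*[1+r] (w zero) _) (ℕ.*-monoʳ-≤ k (value<k^N (w ∘ suc)))

  ≻⇒value> : ∀ {N k} {w′ w : Fin N → Fin k} → w′ ≻ w → value w ℕ.< value w′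
  ≻⇒value> {suc N} {k} {w′} {w} (zero , above , w0<w′0) =
    subst (λ r → toℕ (w zero) + k * r ℕ.< toℕ (w′ zero) + k * value (w′ ∘ suc))
          (value-cong (λ t → above (suc t) ℕ.z<s))
          (ℕ.+-monoˡ-< (k * value (w′ ∘ suc)) w0<w′0)
  ≻⇒value> {suc N} {k} {w′} {w} (suc p , above , wp<w′p) = begin-strict
    toℕ (w zero) + k * value (w ∘ suc)   <⟨ digit+k*r<k*[1+r] (w zero) _ ⟩
    k * suc (value (w ∘ suc))             ≤⟨ ℕ.*-monoʳ-≤ k (≻⇒value> tail≻tail) ⟩
    k * value (w′ ∘ suc)                  ≤⟨ ℕ.m≤n+m _ (toℕ (w′ zero)) ⟩
    toℕ (w′ zero) + k * value (w′ ∘ suc) ∎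
    where
      open ℕ.≤-Reasoning
      tail≻tail : (w′ ∘ suc) ≻ (w ∘ suc)
      tail≻tail = p , (λ t p<t → above (suc t) (ℕ.s≤s p<t)) , wp<w′p

  ≻-wellFounded : ∀ {N k} → WellFounded (_≻_ {N} {k})
  ≻-wellFounded {N} {k} = WF.Subrelation.wellFounded ≻⇒gap< (On.wellFounded gap ℕ.<-wellFounded)
    where
      gap : (Fin N → Fin k) → ℕ
      gap w = k ^ N ∸ value w
      ≻⇒gap< : ∀ {w′ w} → w′ ≻ w → gap w′ ℕ.< gap w
      ≻⇒gap< {w′} w′≻w = ℕ.∸-monoʳ-< (≻⇒value> w′≻w) (ℕ.<⇒≤ (value<k^N w′))

-- Moving a letter to the right

toℕ-punchIn-< : ∀ {n} (i : Fin (suc n)) (j : Fin n) → j < i → toℕ (punchIn i j) ≡ toℕ j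
toℕ-punchIn-< (suc i) zero    _             = refl
toℕ-punchIn-< (suc i) (suc j) (ℕ.s≤s j<i)   = cong suc (toℕ-punchIn-< i j j<i)

toℕ-punchIn-≥ : ∀ {n} (i : Fin (suc n)) (j : Fin n) → i ≤ j → toℕ (punchIn i j) ≡ suc (toℕ j)
toℕ-punchIn-≥ zero    j       _             = refl
toℕ-punchIn-≥ (suc i) (suc j) (ℕ.s≤s i≤j)   = cong suc (toℕ-punchIn-≥ i j i≤j)

toℕ-punchOut-< : ∀ {n} {i j : Fin (suc n)} (i≢j : i ≢ j) → j < i → toℕ (punchOut i≢j) ≡ toℕ j
toℕ-punchOut-< {suc n} {suc i} {zero}  _   _           = refl
toℕ-punchOut-< {suc n} {suc i} {suc j} i≢j (ℕ.s≤s j<i) = cong suc (toℕ-punchOut-< (i≢j ∘ cong suc) j<i)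

toℕ-punchOut-> : ∀ {n} {i j : Fin (suc n)} (i≢j : i ≢ j) → i < j → suc (toℕ (punchOut i≢j)) ≡ toℕ j
toℕ-punchOut-> {n}     {zero}  {suc j} _   _           = refl
toℕ-punchOut-> {suc n} {suc i} {suc j} i≢j (ℕ.s≤s i<j) = cong suc (toℕ-punchOut-> (i≢j ∘ cong suc) i<j)

-- cycle a p moves position a to position p; for a ≤ p it shifts the positions
-- a+1, …, p one step down and fixes everything outside [a, p].
cycle : ∀ {N} → Fin N → Fin N → Permutation′ N
cycle {suc N} a p = insert a p Perm.id

cycle-source : ∀ {N} (a p : Fin N) → cycle a p ⟨$⟩ʳ a ≡ p
cycle-source {suc N} a p with a ≟ a
... | yes _  = refl
... | no a≢a = ⊥-elim (a≢a refl)

cycle-other : ∀ {N} (a p : Fin (suc N)) {t} (a≢t : a ≢ t) → cycle a p ⟨$⟩ʳ t ≡ punchIn p (punchOut a≢t)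
cycle-other a p a≢t = trans (cong (cycle a p ⟨$⟩ʳ_) (sym (punchIn-punchOut a≢t)))
                            (insert-punchIn a p Perm.id (punchOut a≢t))

cycle-mono : ∀ {N} (a p : Fin N) {s t} → a ≢ s → a ≢ t → s ≤ t → cycle a p ⟨$⟩ʳ s ≤ cycle a p ⟨$⟩ʳ t
cycle-mono {suc N} a p a≢s a≢t s≤t rewrite cycle-other a p a≢s | cycle-other a p a≢t =
  punchIn-mono-≤ p _ _ (punchOut-mono-≤ a≢s a≢t s≤t)

cycle-fixed-below : ∀ {N} (a p : Fin N) → a ≤ p → ∀ {t} → t < a → cycle a p ⟨$⟩ʳ t ≡ t
cycle-fixed-below {suc N} a p a≤p {t} t<a = toℕ-injective (begin
  toℕ (cycle a p ⟨$⟩ʳ t)         ≡⟨ cong toℕ (cycle-other a p a≢t) ⟩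
  toℕ (punchIn p (punchOut a≢t)) ≡⟨ toℕ-punchIn-< p _ (ℕ.≤-<-trans (ℕ.≤-reflexive po≡t) (ℕ.<-≤-trans t<a a≤p)) ⟩
  toℕ (punchOut a≢t)             ≡⟨ po≡t ⟩
  toℕ t                          ∎)
  where
    open ≡-Reasoning
    a≢t : a ≢ t
    a≢t = ≢-sym (<⇒≢ t<a)
    po≡t : toℕ (punchOut a≢t) ≡ toℕ t
    po≡t = toℕ-punchOut-< a≢t t<a

cycle-fixed-above : ∀ {N} (a p : Fin N) → a ≤ p → ∀ {t} → p < t → cycle a p ⟨$⟩ʳ t ≡ t
cycle-fixed-above {suc N} a p a≤p {t} p<t = toℕ-injective (begin
  toℕ (cycle a p ⟨$⟩ʳ t)         ≡⟨ cong toℕ (cycle-other a p a≢t) ⟩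
  toℕ (punchIn p (punchOut a≢t)) ≡⟨ toℕ-punchIn-≥ p _ (ℕ.≤-pred (ℕ.≤-trans p<t (ℕ.≤-reflexive (sym po≡t)))) ⟩
  suc (toℕ (punchOut a≢t))       ≡⟨ po≡t ⟩
  toℕ t                          ∎)
  where
    open ≡-Reasoning
    a<t : a < t
    a<t = ℕ.≤-<-trans a≤p p<t
    a≢t : a ≢ t
    a≢t = <⇒≢ a<t
    po≡t : suc (toℕ (punchOut a≢t)) ≡ toℕ t
    po≡t = toℕ-punchOut-> a≢t a<t

module _ {F : PForest} {N k : ℕ} {w : Fin N → Fin k} (ρ : Realization F w) where
  open PForest F
  open Realization ρ

  record Move : Set where
    field
      vertex    : Fin n
      target    : Fin N
      later     : φ ⟨$⟩ʳ vertex < target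
      smaller   : w target < w (φ ⟨$⟩ʳ vertex)
      before-ancestors : ∀ b → ↠ F vertex b ≡ true → b ≢ vertex → target < φ ⟨$⟩ʳ b

  -- Descendants of the vertex precede it and stay in place, while its proper ancestors lie
  -- beyond the target, so cycling the vertex to the target keeps the placement monotone.
  move⇒≻ : Move → ∃ λ w′ → w′ ≻ w × Realization F w′ × (Surjective w → Surjective w′)
  move⇒≻ m = w ∘ (π ⟨$⟩ˡ_) , (target , above , smaller′) , realization , surjective
    where
      open Move m
      u : Fin n
      u = vertex
      π : Permutation′ N
      π = cycle (φ ⟨$⟩ʳ u) target
      u≤target : φ ⟨$⟩ʳ u ≤ target
      u≤target = ℕ.<⇒≤ later
      π⁻¹-fixed : ∀ {t} → π ⟨$⟩ʳ t ≡ t → π ⟨$⟩ˡ t ≡ t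
      π⁻¹-fixed e = trans (cong (π ⟨$⟩ˡ_) (sym e)) (inverseˡ π)
      above : ∀ t → target < t → w (π ⟨$⟩ˡ t) ≡ w t
      above t target<t = cong w (π⁻¹-fixed (cycle-fixed-above _ _ u≤target target<t))
      π⁻¹-target : π ⟨$⟩ˡ target ≡ φ ⟨$⟩ʳ u
      π⁻¹-target = trans (cong (π ⟨$⟩ˡ_) (sym (cycle-source _ _))) (inverseˡ π)
      smaller′ : w target < w (π ⟨$⟩ˡ target)
      smaller′ = subst (λ x → w target < w x) (sym π⁻¹-target) smaller
      descendant-before : ∀ {a} → ↠ F a u ≡ true → a ≢ u → φ ⟨$⟩ʳ a < φ ⟨$⟩ʳ u
      descendant-before a↠u a≢u = ≤∧≢⇒< (monotone _ u a↠u) (a≢u ∘ ⟨$⟩ʳ-injective φ)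
      monotone′ : ∀ a b → ↠ F a b ≡ true → π ⟨$⟩ʳ (φ ⟨$⟩ʳ a) ≤ π ⟨$⟩ʳ (φ ⟨$⟩ʳ b)
      monotone′ a b a↠b with a ≟ u | b ≟ u
      ... | yes refl | yes refl = ℕ.≤-refl
      ... | yes refl | no b≢u
        rewrite cycle-source (φ ⟨$⟩ʳ u) target
              | cycle-fixed-above _ _ u≤target (before-ancestors b a↠b b≢u) = ℕ.<⇒≤ (before-ancestors b a↠b b≢u)
      ... | no a≢u | yes refl
        rewrite cycle-source (φ ⟨$⟩ʳ u) target
              | cycle-fixed-below _ _ u≤target (descendant-before a↠b a≢u) =
        ℕ.<⇒≤ (ℕ.<-trans (descendant-before a↠b a≢u) later)
      ... | no a≢u | no b≢u =
        cycle-mono _ _ (a≢u ∘ ⟨$⟩ʳ-injective φ ∘ sym) (b≢u ∘ ⟨$⟩ʳ-injective φ ∘ sym) (monotone a b a↠b)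
      realization : Realization F (w ∘ (π ⟨$⟩ˡ_))
      realization = record
        { φ        = φ ∘ₚ π
        ; labels   = λ v → trans (labels v) (cong (toℕ ∘ w) (sym (inverseˡ π)))
        ; monotone = monotone′
        }
      surjective : Surjective w → Surjective (w ∘ (π ⟨$⟩ˡ_))
      surjective w-onto j with w-onto j
      ... | i , wi≡j = π ⟨$⟩ʳ i , trans (cong w (inverseˡ π)) wi≡j

  parent-smallerAfter : IsHeap F → ∀ {v z} → parent v ≡ just z → SmallerAfter w (φ ⟨$⟩ʳ v) (φ ⟨$⟩ʳ z)
  parent-smallerAfter heap {v} {z} pv =
      ≤∧≢⇒< (monotone v z (↠-parent F pv))
            (λ e → parent-irrefl F v (subst (λ x → parent v ≡ just x) (sym (⟨$⟩ʳ-injective φ e)) pv))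
    , subst₂ ℕ._<_ (labels z) (labels v) (heap-parent F heap pv)

  ancestor-after-parent : ∀ {u z} → parent u ≡ just z → ∀ b → ↠ F u b ≡ true → b ≢ u → φ ⟨$⟩ʳ z ≤ φ ⟨$⟩ʳ b
  ancestor-after-parent pu b u↠b b≢u with ↠-step F u↠b (≢-sym b≢u)
  ... | z′ , pu′ , z′↠b rewrite just-injective (trans (sym pu) pu′) = monotone _ b z′↠b

  nearestSmaller⇒move : ∀ {u t} → nearestSmaller w (φ ⟨$⟩ʳ u) ≡ just t →
                        (∀ b → ↠ F u b ≡ true → b ≢ u → t < φ ⟨$⟩ʳ b) → Move
  nearestSmaller⇒move {u} {t} nu before-ancestors = record
    { vertex = u ; target = t
    ; later = proj₁ (proj₁ (first-just _ nu)) ; smaller = proj₂ (proj₁ (first-just _ nu))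
    ; before-ancestors = before-ancestors
    }

  -- By the heap condition the parent of u carries a smaller letter to the right of u, so the
  -- nearest such position exists and can only differ from the parent's by preceding it.
  mismatch⇒move : IsHeap F → ∀ u → ¬ NiceAt F w ρ u → Move
  mismatch⇒move heap u mismatch with parent u in pu | nearestSmaller w (φ ⟨$⟩ʳ u) in nu
  ... | nothing | nothing = ⊥-elim (mismatch refl)
  ... | just z  | nothing = ⊥-elim (first-nothing _ nu (φ ⟨$⟩ʳ z) (parent-smallerAfter heap pu))
  ... | nothing | just t  = nearestSmaller⇒move nu no-ancestors
    where
      no-ancestors : ∀ b → ↠ F u b ≡ true → b ≢ u → t < φ ⟨$⟩ʳ b
      no-ancestors b u↠b b≢u with ↠-step F u↠b (≢-sym b≢u)
      ... | _ , pu′ , _ with trans (sym pu) pu′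
      ... | ()
  ... | just z  | just t  =
    nearestSmaller⇒move nu (λ b u↠b b≢u → ℕ.<-≤-trans t<z (ancestor-after-parent pu b u↠b b≢u))
    where
      t<z : t < φ ⟨$⟩ʳ z
      t<z with <-cmp t (φ ⟨$⟩ʳ z)
      ... | tri< t<z _ _ = t<z
      ... | tri≈ _ t≡z _ = ⊥-elim (mismatch (cong just (sym t≡z)))
      ... | tri> _ _ z<t = ⊥-elim (proj₂ (first-just _ nu) (φ ⟨$⟩ʳ z) z<t (parent-smallerAfter heap pu))

  ¬nice⇒move : IsHeap F → ¬ Nice F w ρ → Move
  ¬nice⇒move heap ¬nice with ¬∀⟶∃¬ n _ (niceAt? F w ρ) ¬nice
  ... | u , mismatch = mismatch⇒move heap u mismatch

-- A first realization of a heap-preordered forest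

count : ∀ {n} {P : Pred (Fin n) 0ℓ} → Decidable P → ℕ
count {zero}  P? = 0
count {suc n} P? = (if does (P? zero) then 1 else 0) ℕ.+ count (P? ∘ suc)

count-mono-≤ : ∀ {n} {P Q : Pred (Fin n) 0ℓ} (P? : Decidable P) (Q? : Decidable Q) →
               (∀ {x} → P x → Q x) → count P? ℕ.≤ count Q?
count-mono-≤ {zero}  P? Q? P⊆Q = ℕ.z≤n
count-mono-≤ {suc n} P? Q? P⊆Q with P? zero | Q? zero
... | yes _  | yes _  = ℕ.s≤s (count-mono-≤ (P? ∘ suc) (Q? ∘ suc) P⊆Q)
... | yes P0 | no ¬Q0 = ⊥-elim (¬Q0 (P⊆Q P0))
... | no _   | yes _  = ℕ.m≤n⇒m≤1+n (count-mono-≤ (P? ∘ suc) (Q? ∘ suc) P⊆Q)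
... | no _   | no _   = count-mono-≤ (P? ∘ suc) (Q? ∘ suc) P⊆Q

count-mono-< : ∀ {n} {P Q : Pred (Fin n) 0ℓ} (P? : Decidable P) (Q? : Decidable Q) →
               (∀ {x} → P x → Q x) → ∀ y → ¬ P y → Q y → count P? ℕ.< count Q?
count-mono-< {suc n} P? Q? P⊆Q zero ¬P0 Q0 with P? zero | Q? zero
... | yes P0 | _      = ⊥-elim (¬P0 P0)
... | no _   | no ¬Q0 = ⊥-elim (¬Q0 Q0)
... | no _   | yes _  = ℕ.s≤s (count-mono-≤ (P? ∘ suc) (Q? ∘ suc) P⊆Q)
count-mono-< {suc n} P? Q? P⊆Q (suc y) ¬Py Qy with P? zero | Q? zero
... | yes _  | yes _  = ℕ.s≤s (count-mono-< (P? ∘ suc) (Q? ∘ suc) P⊆Q y ¬Py Qy)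
... | yes P0 | no ¬Q0 = ⊥-elim (¬Q0 (P⊆Q P0))
... | no _   | yes _  = ℕ.m≤n⇒m≤1+n (count-mono-< (P? ∘ suc) (Q? ∘ suc) P⊆Q y ¬Py Qy)
... | no _   | no _   = count-mono-< (P? ∘ suc) (Q? ∘ suc) P⊆Q y ¬Py Qy

count-all : ∀ {n} → count {n} (λ _ → yes tt) ≡ n
count-all {zero}  = refl
count-all {suc n} = cong suc count-all

count<n : ∀ {n} {P : Pred (Fin n) 0ℓ} (P? : Decidable P) x → ¬ P x → count P? ℕ.< n
count<n P? x ¬Px = subst (count P? ℕ.<_) count-all (count-mono-< P? (λ _ → yes tt) (λ _ → tt) x ¬Px tt)

module _ {n m : ℕ} (f : Fin n → Fin m) where

  rank : Fin n → Fin n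
  rank v = fromℕ< (count<n (λ u → f v <? f u) v (<-irrefl refl))

  rank-antitone : ∀ {a b} → f b < f a → rank a < rank b
  rank-antitone {a} {b} fb<fa = subst₂ ℕ._<_ (sym (toℕ-fromℕ< _)) (sym (toℕ-fromℕ< _))
    (count-mono-< (λ u → f a <? f u) (λ u → f b <? f u) (ℕ.<-trans fb<fa) a (<-irrefl refl) fb<fa)

  rank-injective : Injective _≡_ _≡_ f → ∀ {a b} → rank a ≡ rank b → a ≡ b
  rank-injective f-injective {a} {b} e with <-cmp (f a) (f b)
  ... | tri< fa<fb _ _ = ⊥-elim (<⇒≢ (rank-antitone fa<fb) (sym e))
  ... | tri≈ _ fa≡fb _ = f-injective fa≡fb
  ... | tri> _ _ fb<fa = ⊥-elim (<⇒≢ (rank-antitone fb<fa) e)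

injective⇒no-missing-value : ∀ {n} (f : Fin n → Fin n) → Injective _≡_ _≡_ f →
                             ∀ y → ¬ (∀ x → y ≢ f x)
injective⇒no-missing-value {suc n} f f-injective y y≢f
  with i , j , i<j , gi≡gj ← pigeonhole (ℕ.n<1+n n) (λ x → punchOut (y≢f x))
  = <⇒≢ i<j (f-injective (punchOut-injective (y≢f i) (y≢f j) gi≡gj))

injective⇒surjective : ∀ {n} (f : Fin n → Fin n) → Injective _≡_ _≡_ f → ∀ y → ∃ λ x → f x ≡ y
injective⇒surjective f f-injective y with any? (λ x → f x ≟ y)
... | yes hit  = hit
... | no  miss = ⊥-elim (injective⇒no-missing-value f f-injective y (λ x y≡fx → miss (x , sym y≡fx)))

injective⇒permutation : ∀ {n} (f : Fin n → Fin n) → Injective _≡_ _≡_ f → Permutation′ n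
injective⇒permutation f f-injective =
  permutation f (proj₁ ∘ surj) (proj₂ ∘ surj) (λ x → f-injective (proj₂ (surj (f x))))
  where
    surj : ∀ y → ∃ λ x → f x ≡ y
    surj = injective⇒surjective f f-injective

-- The vertices are listed by decreasing label, ties broken by decreasing index.
initialRealization : (F : PForest) → IsHeap F →
                     ∃ λ (w : Fin (PForest.n F) → Fin (PForest.q F)) → Realization F w × Surjective w
initialRealization F heap = σ ∘ (φ ⟨$⟩ˡ_) , realization , surjective
  where
    open PForest F
    key : Fin n → Fin (q ℕ.* n)
    key v = combine (σ v) v
    key-injective : Injective _≡_ _≡_ key
    key-injective {a} {b} e = proj₂ (combine-injective (σ a) a (σ b) b e)
    φ : Permutation′ n
    φ = injective⇒permutation (rank key) (rank-injective key key-injective)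
    monotone : ∀ a b → ↠ F a b ≡ true → φ ⟨$⟩ʳ a ≤ φ ⟨$⟩ʳ b
    monotone a b a↠b with a ≟ b
    ... | yes refl = ℕ.≤-refl
    ... | no a≢b   = ℕ.<⇒≤ (rank-antitone key (combine-monoˡ-< b a (heap a b a≢b a↠b)))
    realization : Realization F (σ ∘ (φ ⟨$⟩ˡ_))
    realization = record
      { φ        = φ
      ; labels   = λ v → cong (toℕ ∘ σ) (sym (inverseˡ φ))
      ; monotone = monotone
      }
    surjective : Surjective (σ ∘ (φ ⟨$⟩ˡ_))
    surjective j with σ-surj j
    ... | v , σv≡j = φ ⟨$⟩ʳ v , trans (cong σ (inverseˡ φ)) σv≡j

-- Triangularity

module _ {c ℓ} (K : CharZeroField c ℓ) where
  open CharZeroField K hiding (sym; trans; zero) renaming (refl to ≈-refl)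
  open import Relation.Binary.Reasoning.Setoid setoid

  ΣK-≈0 : ∀ r (f : Fin r → Carrier) → (∀ j → f j ≈ 0#) → ΣK K r f ≈ 0#
  ΣK-≈0 zero    f f≈0 = ≈-refl
  ΣK-≈0 (suc r) f f≈0 = begin
    f zero + ΣK K r (f ∘ suc)  ≈⟨ +-cong (f≈0 zero) (ΣK-≈0 r (f ∘ suc) (f≈0 ∘ suc)) ⟩
    0# + 0#                    ≈⟨ +-identityˡ 0# ⟩
    0#                         ∎

  ΣK-single : ∀ r (f : Fin r → Carrier) i → (∀ j → j ≢ i → f j ≈ 0#) → ΣK K r f ≈ f i
  ΣK-single (suc r) f zero    f≈0 = begin
    f zero + ΣK K r (f ∘ suc)  ≈⟨ +-congˡ (ΣK-≈0 r (f ∘ suc) (λ j → f≈0 (suc j) λ ())) ⟩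
    f zero + 0#                ≈⟨ +-identityʳ (f zero) ⟩
    f zero                     ∎
  ΣK-single (suc r) f (suc i) f≈0 = begin
    f zero + ΣK K r (f ∘ suc)  ≈⟨ +-cong (f≈0 zero λ ())
                                          (ΣK-single r (f ∘ suc) i λ j j≢i → f≈0 (suc j) (j≢i ∘ suc-injective)) ⟩
    0# + f (suc i)             ≈⟨ +-identityˡ (f (suc i)) ⟩
    f (suc i)                  ∎

  *-fromℕ-suc-cancelʳ : ∀ x m → x * fromℕ (suc m) ≈ 0# → x ≈ 0#
  *-fromℕ-suc-cancelʳ x m x*m+1≈0 with inverse (fromℕ (suc m)) (charZero m)
  ... | y , [m+1]*y≈1 = begin
    x                        ≈⟨ *-identityʳ x ⟨
    x * 1#                   ≈⟨ *-congˡ [m+1]*y≈1 ⟨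
    x * (fromℕ (suc m) * y)  ≈⟨ *-assoc x _ y ⟨
    x * fromℕ (suc m) * y    ≈⟨ *-congʳ x*m+1≈0 ⟩
    0# * y                   ≈⟨ zeroˡ y ⟩
    0#                       ∎

  module _ (r : ℕ) (F : Fin r → HPForest)
           (distinct : ∀ i j → Iso (HPForest.forest (F i)) (HPForest.forest (F j)) → i ≡ j)
           (coeff : Fin r → Carrier)
           (relation : ∀ N k (τ : Fin N → Fin k) → Surjective τ →
              ΣK K r (λ i → coeff i * fromℕ (card-S (HPForest.forest (F i)) τ)) ≈ 0#)
           where

    private
      forest : Fin r → PForest
      forest i = HPForest.forest (F i)

    CoeffsVanishOn : ∀ {N k} → (Fin N → Fin k) → Set ℓ
    CoeffsVanishOn w = Surjective w → ∀ j → Realization (forest j) w → coeff j ≈ 0#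

    module _ {N k : ℕ} {w : Fin N → Fin k}
             (ih : ∀ {w′} → w′ ≻ w → CoeffsVanishOn w′) (w-onto : Surjective w) where

      nice-or-≈0 : ∀ {l} (ρ : Realization (forest l) w) → Nice (forest l) w ρ ⊎ coeff l ≈ 0#
      nice-or-≈0 {l} ρ with nice? (forest l) w ρ
      ... | yes nice = inj₁ nice
      ... | no ¬nice with w′ , w′≻w , ρ′ , onto ← move⇒≻ ρ (¬nice⇒move ρ (HPForest.heap (F l)) ¬nice)
        = inj₂ (ih w′≻w (onto w-onto) l ρ′)

      other-term≈0 : ∀ {j} (ρ : Realization (forest j) w) → Nice (forest j) w ρ →
                     ∀ l → l ≢ j → coeff l * fromℕ (card-S (forest l) w) ≈ 0#
      other-term≈0 ρ ρ-nice l l≢j with card-S (forest l) w in card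
      ... | zero  = zeroʳ (coeff l)
      ... | suc m with θ ← card-S≡suc⇒realization (forest l) w card | nice-or-≈0 θ
      ...   | inj₁ θ-nice  = ⊥-elim (l≢j (distinct l _ (nice⇒iso θ ρ θ-nice ρ-nice)))
      ...   | inj₂ coeff≈0 = begin
        coeff l * fromℕ (suc m)  ≈⟨ *-congʳ coeff≈0 ⟩
        0# * fromℕ (suc m)       ≈⟨ zeroˡ _ ⟩
        0#                       ∎

      nice⇒coeff≈0 : ∀ {j} (ρ : Realization (forest j) w) → Nice (forest j) w ρ → coeff j ≈ 0#
      nice⇒coeff≈0 {j} ρ ρ-nice with m , card ← realization⇒card-S≡suc (forest j) w ρ =
        *-fromℕ-suc-cancelʳ (coeff j) m (begin
          coeff j * fromℕ (suc m)                               ≡⟨ cong (λ c → coeff j * fromℕ c) card ⟨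
          coeff j * fromℕ (card-S (forest j) w)                 ≈⟨ ΣK-single r _ j (other-term≈0 ρ ρ-nice) ⟨
          ΣK K r (λ i → coeff i * fromℕ (card-S (forest i) w))  ≈⟨ relation N k w w-onto ⟩
          0#                                                    ∎)

    coeffsVanishOn : ∀ {N k} (w : Fin N → Fin k) → CoeffsVanishOn w
    coeffsVanishOn = WF.All.wfRec ≻-wellFounded ℓ CoeffsVanishOn λ w ih w-onto j ρ →
      [ nice⇒coeff≈0 ih w-onto ρ , id ]′ (nice-or-≈0 ih w-onto ρ)

mainTheorem3 : ∀ {c ℓ} (K : CharZeroField c ℓ) →
    let open CharZeroField K in
    (r : ℕ) (F : Fin r → HPForest) →
    (∀ i j → Iso (HPForest.forest (F i)) (HPForest.forest (F j)) → i ≡ j) →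
    (coeff : Fin r → Carrier) →
    (∀ N k (τ : Fin N → Fin k) → Surjective τ →
       ΣK K r (λ i → coeff i * fromℕ (card-S (HPForest.forest (F i)) τ)) ≈ 0#) →
    ∀ i → coeff i ≈ 0#
mainTheorem3 K r F distinct coeff relation i
  with w , ρ , w-onto ← initialRealization (HPForest.forest (F i)) (HPForest.heap (F i))
  = coeffsVanishOn K r F distinct coeff relation w w-onto i ρ
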